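{- For every modal formula $\phi$ with $\phi\wedge\sim\phi\in\mathsf{CnK}$, we have $\Box\phi\wedge\sim\Box\phi\in\mathsf{CnK}$. In particular, whenever $(\phi\to\psi)\wedge\sim(\phi\to\psi)\in\mathsf{CnK}$, we have $(\phi\to_s\psi)\wedge\sim(\phi\to_s\psi)\in\mathsf{CnK}$; and whenever $(\phi\Rightarrow\psi)\wedge\sim(\phi\Rightarrow\psi)\in\mathsf{CnK}$, we have $(\phi\Rightarrow_s\psi)\wedge\sim(\phi\Rightarrow_s\psi)\in\mathsf{CnK}$.
   Context: Modal formulas are built from propositional letters with $\wedge,\vee,\to,\sim$ (strong negation), $\Box,\Diamond$. Abbreviations: $\phi\Rightarrow\psi:=(\phi\to\psi)\wedge(\sim\psi\to\sim\phi)$; $\phi\to_s\psi:=\Box(\phi\to\psi)$; $\phi\Rightarrow_s\psi:=\Box(\phi\Rightarrow\psi)$. A modal Fischer-Servi model is $(W,\leq,R,V^+,V^-)$ with $W\neq\emptyset$, $\leq$ a preorder, $R\subseteq W\times W$, $V^\pm$ maps letters to $\leq$-upward closed subsets, satisfying (c1) $w\leq w'$, $wRv$ imply $w'Rv'$, $v\leq v'$ for some $v'$; (c2) $wRv$, $v\leq v'$ imply $w\leq w'$, $w'Rv'$ for some $w'$. Verification/falsification: $w\models^\pm p$ iff $w\in V^\pm(p)$; $\wedge$: $+$ iff both $+$, $-$ iff some $-$; $\vee$: $+$ iff some $+$, $-$ iff both $-$; $w\models^\pm\sim\psi$ iff $w\models^\mp\psi$; $w\models^+\psi\to\chi$ iff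 $\forall v\geq w(v\models^+\psi\Rightarrow v\models^+\chi)$; $w\models^-\psi\to\chi$ iff $\forall v\geq w(v\models^+\psi\Rightarrow v\models^-\chi)$; $w\models^\pm\Box\psi$ iff $\forall v\geq w\,\forall u(vRu\Rightarrow u\models^\pm\psi)$; $w\models^\pm\Diamond\psi$ iff $\exists u(wRu$ and $u\models^\pm\psi)$. $\phi\in\mathsf{CnK}$ iff $\phi$ is verified at every world of every such model. -}

module Defs where

open import Data.Nat using (ℕ)
open import Data.Product using (Σ; ∃; _×_; _,_)
open import Relation.Binary.Core using (Rel)
open import Relation.Binary.Definitions using (Reflexive; Transitive)

data Form : Set where
  var  : ℕ → Form
  _∧_  : Form → Form → Form
  _∨_  : Form → Form → Form
  _⟶_  : Form → Form → Form
  ∼_   : Form → Form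
  □_   : Form → Form
  ◇_   : Form → Form

infixr 6 _∧_
infixr 5 _∨_
infixr 4 _⟶_

_⇛_ : Form → Form → Form
φ ⇛ ψ = (φ ⟶ ψ) ∧ ((∼ ψ) ⟶ (∼ φ))

_⟶ₛ_ : Form → Form → Form
φ ⟶ₛ ψ = □ (φ ⟶ ψ)

_⇛ₛ_ : Form → Form → Form
φ ⇛ₛ ψ = □ (φ ⇛ ψ)

record Model : Set₁ where
  field
    W      : Set
    inhab  : W
    _≤_    : Rel W _
    ≤-refl  : Reflexive _≤_
    ≤-trans : Transitive _≤_
    R      : Rel W _
    V⁺     : ℕ → W → Set
    V⁻     : ℕ → W → Set
    V⁺-up  : ∀ p {w w'} → w ≤ w' → V⁺ p w → V⁺ p w'
    V⁻-up  : ∀ p {w w'} → w ≤ w' → V⁻ p w → V⁻ p w'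
    c1     : ∀ {w w' v} → w ≤ w' → R w v → Σ W (λ v' → R w' v' × v ≤ v')
    c2     : ∀ {w v v'} → R w v → v ≤ v' → Σ W (λ w' → w ≤ w' × R w' v')

module _ (M : Model) where
  open Model M

  _⊨⁺_ : W → Form → Set
  _⊨⁻_ : W → Form → Set

  w ⊨⁺ var p   = V⁺ p w
  w ⊨⁺ (φ ∧ ψ) = (w ⊨⁺ φ) × (w ⊨⁺ ψ)
  w ⊨⁺ (φ ∨ ψ) = (w ⊨⁺ φ) Data.Sum.⊎ (w ⊨⁺ ψ)
    where import Data.Sum
  w ⊨⁺ (φ ⟶ ψ) = ∀ v → w ≤ v → v ⊨⁺ φ → v ⊨⁺ ψ
  w ⊨⁺ (∼ φ)   = w ⊨⁻ φ
  w ⊨⁺ (□ φ)   = ∀ v → w ≤ v → ∀ u → R v u → u ⊨⁺ φ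
  w ⊨⁺ (◇ φ)   = Σ W (λ u → R w u × u ⊨⁺ φ)

  w ⊨⁻ var p   = V⁻ p w
  w ⊨⁻ (φ ∧ ψ) = (w ⊨⁻ φ) Data.Sum.⊎ (w ⊨⁻ ψ)
    where import Data.Sum
  w ⊨⁻ (φ ∨ ψ) = (w ⊨⁻ φ) × (w ⊨⁻ ψ)
  w ⊨⁻ (φ ⟶ ψ) = ∀ v → w ≤ v → v ⊨⁺ φ → v ⊨⁻ ψ
  w ⊨⁻ (∼ φ)   = w ⊨⁺ φ
  w ⊨⁻ (□ φ)   = ∀ v → w ≤ v → ∀ u → R v u → u ⊨⁻ φ
  w ⊨⁻ (◇ φ)   = Σ W (λ u → R w u × u ⊨⁻ φ)

CnK : Form → Set₁
CnK φ = ∀ (M : Model) (w : Model.W M) → _⊨⁺_ M w φ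

{-# OPTIONS --safe #-}
module Submission where

open import Defs
open import Data.Product using (_×_; _,_; proj₁; proj₂)
open import Function.Bundles using (_⇔_; mk⇔; Equivalence)

-- Verification and falsification of □ φ at w are both universal over the worlds
-- R-accessible from ≤-successors of w, so □ preserves validity of φ and of ∼ φ alike.

private
  variable
    φ ψ : Form

CnK-∧ : CnK (φ ∧ ψ) ⇔ (CnK φ × CnK ψ)
CnK-∧ = mk⇔ (λ ⊨φ∧ψ → (λ M w → proj₁ (⊨φ∧ψ M w)) , (λ M w → proj₂ (⊨φ∧ψ M w)))
            (λ (⊨φ , ⊨ψ) M w → ⊨φ M w , ⊨ψ M w)

CnK-□ : CnK φ → CnK (□ φ)
CnK-□ ⊨φ M _ _ _ u _ = ⊨φ M u

CnK-∼□ : CnK (∼ φ) → CnK (∼ □ φ)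
CnK-∼□ ⊨∼φ M _ _ _ u _ = ⊨∼φ M u

CnK-□-glut : CnK (φ ∧ ∼ φ) → CnK (□ φ ∧ ∼ □ φ)
CnK-□-glut {φ} ⊨φ∧∼φ =
  let ⊨φ , ⊨∼φ = Equivalence.to (CnK-∧ {φ} {∼ φ}) ⊨φ∧∼φ
  in Equivalence.from (CnK-∧ {□ φ} {∼ □ φ}) (CnK-□ {φ} ⊨φ , CnK-∼□ {φ} ⊨∼φ)

proposition4p22 : (∀ φ → CnK (φ ∧ ∼ φ) → CnK (□ φ ∧ ∼ (□ φ)))
    × (∀ φ ψ → CnK ((φ ⟶ ψ) ∧ ∼ (φ ⟶ ψ)) → CnK ((φ ⟶ₛ ψ) ∧ ∼ (φ ⟶ₛ ψ)))
    × (∀ φ ψ → CnK ((φ ⇛ ψ) ∧ ∼ (φ ⇛ ψ)) → CnK ((φ ⇛ₛ ψ) ∧ ∼ (φ ⇛ₛ ψ)))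
proposition4p22 =
  (λ φ → CnK-□-glut {φ}) ,
  (λ φ ψ → CnK-□-glut {φ ⟶ ψ}) ,
  (λ φ ψ → CnK-□-glut {φ ⇛ ψ})
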